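{- Let $f:\mathbb{Z}_{\geq 1}\to\mathbb{C}$ be an arithmetic function, and let $F(x) := \sum_{n \leq x} f(n)$ be its summatory function. Let $L_f(q) := \sum_{n \geq 1} \frac{f(n) q^n}{1-q^n} = \sum_{m\geq 1}\Big(\sum_{d\mid m} f(d)\Big) q^m$ denote the Lambert series of $f$. Then, as formal power series in $q$, \[ \sum_{n \geq 1} F(n) q^n = \sum_{n \geq 1} \mu(n) \frac{L_f(q^n)}{1-q}, \] where $\mu$ is the Möbius function.
   Context: An arithmetic function is any function $f:\mathbb{Z}_{\geq 1}\to\mathbb{C}$. The Lambert series of $f$ is $L_f(q)=\sum_{n\ge1} f(n)q^n/(1-q^n)$, whose coefficient of $q^m$ is the divisor sum $\sum_{d\mid m} f(d)$. Series are treated as formal power series in $q$ (for each coefficient only finitely many terms contribute). -}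

module Defs where

open import Level using (Level)
open import Algebra.Bundles using (CommutativeRing)
open import Data.Nat as ℕ using (ℕ; zero; suc; _≤_)
open import Data.Nat.Divisibility using (_∣?_)
open import Data.Nat.DivMod using (_/_)
open import Data.Nat.Primality using (prime?)
open import Data.Bool using (Bool; true; false; if_then_else_; _∧_; not)
open import Data.Product using (∃)
open import Relation.Nullary using (does)

countTo : (ℕ → Bool) → ℕ → ℕ
countTo p zero    = zero
countTo p (suc n) = if p (suc n) then suc (countTo p n) else countTo p n

ω : ℕ → ℕ
ω n = countTo (λ p → does (prime? p) ∧ does (p ∣? n)) n

squarefree : ℕ → Bool
squarefree n = countTo (λ k → not (does (k ℕ.≟ 1)) ∧ does ((k ℕ.* k) ∣? n)) n ℕ.≡ᵇ 0

-- Formal power series over a commutative ring R are coefficient functions ℕ → R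
-- (the coefficient of q^m is the value at m); equality is coefficientwise.
module _ {c ℓ : Level} (R : CommutativeRing c ℓ) where
  open CommutativeRing R

  Series : Set c
  Series = ℕ → Carrier

  sum1 : (ℕ → Carrier) → ℕ → Carrier
  sum1 g zero    = 0#
  sum1 g (suc n) = sum1 g n + g (suc n)

  sum0 : (ℕ → Carrier) → ℕ → Carrier
  sum0 g n = g 0 + sum1 g n

  μ : ℕ → Carrier
  μ zero = 0#
  μ n@(suc _) = if squarefree n
                  then (if (ω n ℕ.% 2) ℕ.≡ᵇ 0 then 1# else - 1#)
                  else 0#

  summatory : (ℕ → Carrier) → ℕ → Carrier
  summatory f n = sum1 f n

  divisorSum : (ℕ → Carrier) → ℕ → Carrier
  divisorSum f m = sum1 (λ d → if does (d ∣? m) then f d else 0#) m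

  lambert : (ℕ → Carrier) → Series
  lambert f zero    = 0#
  lambert f (suc m) = divisorSum f (suc m)

  _•_ : Carrier → Series → Series
  (a • S) m = a * S m

  _⊛_ : Series → Series → Series
  (S ⊛ T) m = sum0 (λ i → S i * T (m ℕ.∸ i)) m

  -- 1/(1-q) = Σ_{j ≥ 0} q^j
  geom : Series
  geom _ = 1#

  -- substitution q ↦ q^(k+1):  S(q^(k+1))
  substPow : Series → ℕ → Series
  substPow S k m = if does (suc k ∣? m) then S (m / suc k) else 0#

  -- S is the sum Σ_{n ≥ 1} T n in the formal (q-adic) topology:
  -- for every coefficient m, the partial sums Σ_{n=1}^{N} (T n) m
  -- are eventually equal to S m.
  HasSum : (ℕ → Series) → Series → Set ℓ
  HasSum T S = ∀ m → ∃ λ N → ∀ N′ → N ≤ N′ → sum1 (λ n → T n m) N′ ≈ S m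

  -- the n-th term  μ(n) · L_f(q^n) / (1-q)  of the right-hand side (n ≥ 1);
  -- the index n = 0 is not part of the sum and is set to the zero series.
  rhsTerm : (ℕ → Carrier) → ℕ → Series
  rhsTerm f zero    = λ _ → 0#
  rhsTerm f (suc k) = (μ (suc k) • substPow (lambert f) k) ⊛ geom

  lhsSeries : (ℕ → Carrier) → Series
  lhsSeries f zero    = 0#
  lhsSeries f (suc m) = summatory f (suc m)

{-# OPTIONS --safe #-}
module Submission where

-- Multiplying by 1/(1-q) replaces coefficients by partial sums, so the
-- coefficient of q^m in Σ_{n ≤ N} μ(n) L_f(q^n)/(1-q) is
-- Σ_{i ≤ m} Σ_{n ≤ N, n ∣ i} μ(n) Σ_{d ∣ i/n} f(d).  Once N ≥ m, Möbius
-- inversion turns each inner sum into f(i), leaving F(m).  Möbius inversion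
-- rests on Σ_{n ∣ k} μ(n) = 0 for k ≥ 2: fixing a prime p ∣ k, every divisor j
-- of k/p with p ∤ j is matched with the divisor j p, and μ(j p) = -μ(j), while
-- μ(j p) = 0 when p ∣ j.  Both facts about μ are read off its definition through
-- squarefreeness and the number ω of prime divisors.

open import Defs
open import Level using (Level)
open import Algebra.Bundles using (CommutativeRing)
open import Data.Bool using (Bool; true; false; if_then_else_; not)
open import Data.List using ([]; _∷_)
open import Data.List.Relation.Unary.All using (_∷_)
open import Data.Nat as ℕ
  using (ℕ; zero; suc; _≤_; _<_; _≟_; _≡ᵇ_; _%_; z≤n; s≤s; NonZero; NonTrivial;
         n>1⇒nonTrivial; nonTrivial⇒≢1; nonTrivial⇒nonZero; >-nonZero; >-nonZero⁻¹; ≢-nonZero⁻¹)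
open import Data.Nat.Properties
  using (≤-refl; ≤-trans; ≤-antisym; <⇒≱; ≤∧≢⇒<; m≤n⇒m≤1+n; m≤n⇒m<n∨m≡n; m≤m*n; m≤n*m; m*n≢0;
         ≡ᵇ⇒≡; ≡⇒≡ᵇ)
import Data.Nat.Properties as ℕₚ
open import Data.Nat.Coprimality using (Coprime; coprime-divisor)
open import Data.Nat.Divisibility
open import Data.Nat.DivMod using (_/_; m/n≤m; m≥n⇒m/n>0; m/n*n≡m; n/n≡1)
open import Data.Nat.ListAction using (product)
open import Data.Nat.Primality
open import Data.Nat.Primality.Factorisation using (factorise)
open import Data.Product using (∃-syntax; _×_; _,_; proj₂)
open import Data.Sum using (inj₁; inj₂; [_,_]′)
open import Function.Base using (id; _∘_)
open import Function.Bundles using (_⇔_; mk⇔; Equivalence)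
open import Relation.Nullary using (Dec; yes; no; does; proof; ¬_; _×-dec_; ¬?; contradiction)
open import Relation.Nullary.Decidable using (dec-true; dec-false; does-⇔)
open import Relation.Nullary.Reflects using (fromEquivalence)
open import Relation.Binary.PropositionalEquality
  using (_≡_; _≢_; refl; sym; trans; cong; subst; module ≡-Reasoning)

AllUpTo : ∀ {ℓ} → ℕ → (ℕ → Set ℓ) → Set ℓ
AllUpTo n P = ∀ i → 1 ≤ i → i ≤ n → P i

module _ {ℓ} {P : ℕ → Set ℓ} {n : ℕ} where

  allUpTo-init : AllUpTo (suc n) P → AllUpTo n P
  allUpTo-init all i 1≤i i≤n = all i 1≤i (m≤n⇒m≤1+n i≤n)

  allUpTo-last : AllUpTo (suc n) P → P (suc n)
  allUpTo-last all = all (suc n) (s≤s z≤n) ≤-refl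

countTo-cong : ∀ {p q : ℕ → Bool} n → AllUpTo n (λ i → p i ≡ q i) → countTo p n ≡ countTo q n
countTo-cong zero    _  = refl
countTo-cong (suc n) eq rewrite allUpTo-last eq | countTo-cong n (allUpTo-init eq) = refl

countTo≡0⇔ : ∀ {p : ℕ → Bool} n → countTo p n ≡ 0 ⇔ AllUpTo n (λ i → p i ≡ false)
countTo≡0⇔ {p} n = mk⇔ (to n) (from n)
  where
  to : ∀ n → countTo p n ≡ 0 → AllUpTo n (λ i → p i ≡ false)
  to zero    _ (suc _) _ ()
  to (suc n) count≡0 i 1≤i i≤1+n with p (suc n) in p[1+n] | m≤n⇒m<n∨m≡n i≤1+n
  ... | false | inj₂ refl      = p[1+n]
  ... | false | inj₁ (s≤s i≤n) = to n count≡0 i 1≤i i≤n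
  from : ∀ n → AllUpTo n (λ i → p i ≡ false) → countTo p n ≡ 0
  from zero    _   = refl
  from (suc n) all rewrite allUpTo-last all = from n (allUpTo-init all)

countTo-extend : ∀ {p : ℕ → Bool} {n} N → n ≤ N → (∀ i → n < i → i ≤ N → p i ≡ false) →
                 countTo p N ≡ countTo p n
countTo-extend zero    z≤n _ = refl
countTo-extend (suc N) n≤1+N none with m≤n⇒m<n∨m≡n n≤1+N
... | inj₂ refl      = refl
... | inj₁ (s≤s n≤N) rewrite none (suc N) (s≤s n≤N) ≤-refl =
  countTo-extend N n≤N (λ i n<i i≤N → none i n<i (m≤n⇒m≤1+n i≤N))

countTo-insert : ∀ {p q : ℕ → Bool} {j} n → 1 ≤ j → j ≤ n → p j ≡ true → q j ≡ false →
                 AllUpTo n (λ i → i ≢ j → p i ≡ q i) → countTo p n ≡ suc (countTo q n)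
countTo-insert zero (s≤s z≤n) () _ _ _
countTo-insert {q = q} (suc n) 1≤j j≤1+n pj qj eq with m≤n⇒m<n∨m≡n j≤1+n
... | inj₂ refl rewrite pj | qj =
  cong suc (countTo-cong n (λ i 1≤i i≤n → eq i 1≤i (m≤n⇒m≤1+n i≤n) (λ { refl → <⇒≱ (s≤s i≤n) ≤-refl })))
... | inj₁ (s≤s j≤n)
  rewrite allUpTo-last eq (λ { refl → <⇒≱ (s≤s j≤n) ≤-refl })
        | countTo-insert n 1≤j j≤n pj qj (allUpTo-init eq) with q (suc n)
... | true  = refl
... | false = refl

even-suc : ∀ n → (suc n % 2 ≡ᵇ 0) ≡ not (n % 2 ≡ᵇ 0)
even-suc zero          = refl
even-suc (suc zero)    = refl
even-suc (suc (suc n)) = even-suc n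

∃-prime-divisor : ∀ n .{{_ : NonTrivial n}} → ∃[ p ] Prime p × p ∣ n
∃-prime-divisor n@(suc _) with factorise n
... | record { factors = [] ; isFactorisation = n≡1 } = contradiction n≡1 nonTrivial⇒≢1
... | record { factors = p ∷ ps ; isFactorisation = n≡p*ps ; factorsPrime = prime-p ∷ _ } =
  p , prime-p , subst (p ∣_) (sym n≡p*ps) (m∣m*n (product ps))

prime∣prime⇒≡ : ∀ {p q} → Prime p → Prime q → q ∣ p → q ≡ p
prime∣prime⇒≡ prime-p prime-q q∣p with prime⇒irreducible prime-p q∣p
... | inj₁ refl = contradiction prime-q ¬prime[1]
... | inj₂ q≡p  = q≡p

prime∤⇒coprime : ∀ {p m} → Prime p → ¬ p ∣ m → Coprime m p
prime∤⇒coprime prime-p p∤m (d∣m , d∣p) with prime⇒irreducible prime-p d∣p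
... | inj₁ d≡1 = d≡1
... | inj₂ refl = contradiction d∣m p∤m

SquareFree : ℕ → Set
SquareFree n = ∀ k → k ℕ.* k ∣ n → k ≡ 1

squareFree? : ∀ n .{{_ : NonZero n}} → Dec (SquareFree n)
does  (squareFree? n) = squarefree n
proof (squareFree? n) = fromEquivalence
  (λ t → noSquareFactor⇒squareFree (Equivalence.to (countTo≡0⇔ n) (≡ᵇ⇒≡ _ 0 t)))
  (λ sf → ≡⇒≡ᵇ _ 0 (Equivalence.from (countTo≡0⇔ n) (squareFree⇒noSquareFactor sf)))
  where
  nontrivialSquare? : ∀ k → Dec (k ≢ 1 × k ℕ.* k ∣ n)
  nontrivialSquare? k = ¬? (k ≟ 1) ×-dec (k ℕ.* k) ∣? n
  noSquareFactor⇒squareFree : AllUpTo n (λ k → does (nontrivialSquare? k) ≡ false) → SquareFree n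
  noSquareFactor⇒squareFree none zero      0∣n  = contradiction (0∣⇒≡0 0∣n) (≢-nonZero⁻¹ n)
  noSquareFactor⇒squareFree none k@(suc _) kk∣n with k ≟ 1
  ... | yes k≡1 = k≡1
  ... | no  k≢1 = contradiction
    (trans (sym (dec-true (nontrivialSquare? k) (k≢1 , kk∣n))) (none k (s≤s z≤n) (∣⇒≤ (m*n∣⇒m∣ k k kk∣n))))
    λ ()
  squareFree⇒noSquareFactor : SquareFree n → AllUpTo n (λ k → does (nontrivialSquare? k) ≡ false)
  squareFree⇒noSquareFactor sf k _ _ = dec-false (nontrivialSquare? k) λ (k≢1 , kk∣n) → k≢1 (sf k kk∣n)

squarefree≡false : ∀ n .{{_ : NonZero n}} → ¬ SquareFree n → squarefree n ≡ false
squarefree≡false n = dec-false (squareFree? n)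

¬squareFree[n*p] : ∀ {p n} .{{_ : NonTrivial p}} → p ∣ n → ¬ SquareFree (n ℕ.* p)
¬squareFree[n*p] {p} p∣n sf = nonTrivial⇒≢1 (sf p (*-monoˡ-∣ p p∣n))

squareFree[n*p]⇔ : ∀ {p n} → Prime p → ¬ p ∣ n → SquareFree (n ℕ.* p) ⇔ SquareFree n
squareFree[n*p]⇔ {p} {n} prime-p p∤n = mk⇔ (λ sf k kk∣n → sf k (∣m⇒∣m*n p kk∣n)) from
  where
  instance _ = prime⇒nonZero prime-p
  from : SquareFree n → SquareFree (n ℕ.* p)
  from sf k kk∣np with p ∣? (k ℕ.* k)
  ... | no  p∤kk = sf k (coprime-divisor (prime∤⇒coprime prime-p p∤kk) (subst (k ℕ.* k ∣_) (ℕₚ.*-comm n p) kk∣np))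
  ... | yes p∣kk = contradiction (*-cancelʳ-∣ p (∣-trans (*-pres-∣ p∣k p∣k) kk∣np)) p∤n
    where p∣k = [ id , id ]′ (euclidsLemma k k prime-p p∣kk)

squarefree[n*p] : ∀ {p n} .{{_ : NonZero n}} → Prime p → ¬ p ∣ n → squarefree (n ℕ.* p) ≡ squarefree n
squarefree[n*p] {p} {n} prime-p p∤n =
  does-⇔ (squareFree[n*p]⇔ prime-p p∤n) (squareFree? (n ℕ.* p)) (squareFree? n)
  where
  instance
    _ = prime⇒nonZero prime-p
    _ = m*n≢0 n p

ω[n*p] : ∀ {p n} .{{_ : NonZero n}} → Prime p → ¬ p ∣ n → ω (n ℕ.* p) ≡ suc (ω n)
ω[n*p] {p} {n} prime-p p∤n = begin
  countTo (primeDivisorOf (n ℕ.* p)) (n ℕ.* p)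
    ≡⟨ countTo-insert (n ℕ.* p) (>-nonZero⁻¹ p) (m≤n*m p n)
                      (dec-true (primeDivisor? (n ℕ.* p) p) (prime-p , n∣m*n n))
                      (dec-false (primeDivisor? n p) (p∤n ∘ proj₂))
                      same-away-from-p ⟩
  suc (countTo (primeDivisorOf n) (n ℕ.* p))
    ≡⟨ cong suc (countTo-extend (n ℕ.* p) (m≤m*n n p) none-above-n) ⟩
  suc (ω n)
    ∎
  where
  open ≡-Reasoning
  instance _ = prime⇒nonZero prime-p
  primeDivisor? : ∀ m q → Dec (Prime q × q ∣ m)
  primeDivisor? m q = prime? q ×-dec q ∣? m
  primeDivisorOf : ℕ → ℕ → Bool
  primeDivisorOf m q = does (primeDivisor? m q)
  same-away-from-p : AllUpTo (n ℕ.* p) (λ q → q ≢ p → primeDivisorOf (n ℕ.* p) q ≡ primeDivisorOf n q)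
  same-away-from-p q _ _ q≢p = does-⇔ (mk⇔ to (λ (prime-q , q∣n) → prime-q , ∣m⇒∣m*n p q∣n))
                                      (primeDivisor? (n ℕ.* p) q) (primeDivisor? n q)
    where
    to : Prime q × q ∣ n ℕ.* p → Prime q × q ∣ n
    to (prime-q , q∣np) with euclidsLemma n p prime-q q∣np
    ... | inj₁ q∣n = prime-q , q∣n
    ... | inj₂ q∣p = contradiction (prime∣prime⇒≡ prime-p prime-q q∣p) q≢p
  none-above-n : ∀ q → n < q → q ≤ n ℕ.* p → primeDivisorOf n q ≡ false
  none-above-n q n<q _ = dec-false (primeDivisor? n q) λ (_ , q∣n) → <⇒≱ n<q (∣⇒≤ q∣n)

module _ {c ℓ : Level} (R : CommutativeRing c ℓ) where

  open CommutativeRing R hiding (zero) renaming (refl to ≈-refl; sym to ≈-sym; trans to ≈-trans)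
  open import Algebra.Properties.Ring ring using (-0#≈0#; -‿involutive)
  open import Algebra.Properties.CommutativeSemigroup +-commutativeSemigroup using (interchange)
  open import Relation.Binary.Reasoning.Setoid setoid

  if-yes : ∀ {a} {A : Set a} (a? : Dec A) {x} → A → (if does a? then x else 0#) ≈ x
  if-yes a? a rewrite dec-true a? a = ≈-refl

  if-no : ∀ {a} {A : Set a} (a? : Dec A) {x} → ¬ A → (if does a? then x else 0#) ≈ 0#
  if-no a? ¬a rewrite dec-false a? ¬a = ≈-refl

  if-≈0 : ∀ b {x} → x ≈ 0# → (if b then x else 0#) ≈ 0#
  if-≈0 true  x≈0 = x≈0
  if-≈0 false _   = ≈-refl

  *-if : ∀ a b x → a * (if b then x else 0#) ≈ (if b then a * x else 0#)
  *-if a true  x = ≈-refl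
  *-if a false x = zeroʳ a

  if-∣-beyond : ∀ {k n} .{{_ : NonZero k}} x → k < n → (if does (n ∣? k) then x else 0#) ≈ 0#
  if-∣-beyond {k} {n} x k<n = if-no (n ∣? k) (<⇒≱ k<n ∘ ∣⇒≤)

  sum1-cong : ∀ {g h} n → AllUpTo n (λ i → g i ≈ h i) → sum1 R g n ≈ sum1 R h n
  sum1-cong zero    _  = ≈-refl
  sum1-cong (suc n) eq = +-cong (sum1-cong n (allUpTo-init eq)) (allUpTo-last eq)

  sum1-zero : ∀ {g} n → AllUpTo n (λ i → g i ≈ 0#) → sum1 R g n ≈ 0#
  sum1-zero zero    _      = ≈-refl
  sum1-zero (suc n) vanish =
    ≈-trans (+-cong (sum1-zero n (allUpTo-init vanish)) (allUpTo-last vanish)) (+-identityˡ 0#)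

  sum1-+ : ∀ (g h : ℕ → Carrier) n → sum1 R (λ i → g i + h i) n ≈ sum1 R g n + sum1 R h n
  sum1-+ g h zero    = ≈-sym (+-identityˡ 0#)
  sum1-+ g h (suc n) = ≈-trans (+-congʳ (sum1-+ g h n)) (interchange _ _ _ _)

  sum1-*ˡ : ∀ a (g : ℕ → Carrier) n → sum1 R (λ i → a * g i) n ≈ a * sum1 R g n
  sum1-*ˡ a g zero    = ≈-sym (zeroʳ a)
  sum1-*ˡ a g (suc n) = ≈-trans (+-congʳ (sum1-*ˡ a g n)) (≈-sym (distribˡ a _ _))

  sum1-*ʳ : ∀ a (g : ℕ → Carrier) n → sum1 R (λ i → g i * a) n ≈ sum1 R g n * a
  sum1-*ʳ a g zero    = ≈-sym (zeroˡ a)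
  sum1-*ʳ a g (suc n) = ≈-trans (+-congʳ (sum1-*ʳ a g n)) (≈-sym (distribʳ a _ _))

  sum1-swap : ∀ (g : ℕ → ℕ → Carrier) N M →
    sum1 R (λ a → sum1 R (g a) M) N ≈ sum1 R (λ b → sum1 R (λ a → g a b) N) M
  sum1-swap g zero    M = ≈-sym (sum1-zero M (λ _ _ _ → ≈-refl))
  sum1-swap g (suc N) M = ≈-trans (+-congʳ (sum1-swap g N M)) (≈-sym (sum1-+ _ (g (suc N)) M))

  sum1-extend : ∀ {g n} N → n ≤ N → (∀ i → n < i → i ≤ N → g i ≈ 0#) → sum1 R g N ≈ sum1 R g n
  sum1-extend zero    z≤n   _      = ≈-refl
  sum1-extend (suc N) n≤1+N vanish with m≤n⇒m<n∨m≡n n≤1+N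
  ... | inj₂ refl      = ≈-refl
  ... | inj₁ (s≤s n≤N) =
    ≈-trans (+-cong (sum1-extend N n≤N (λ i n<i i≤N → vanish i n<i (m≤n⇒m≤1+n i≤N)))
                    (vanish (suc N) (s≤s n≤N) ≤-refl))
            (+-identityʳ _)

  sum1-single : ∀ {g j} n → 1 ≤ j → j ≤ n → AllUpTo n (λ i → i ≢ j → g i ≈ 0#) → sum1 R g n ≈ g j
  sum1-single zero    (s≤s z≤n) () _
  sum1-single (suc n) 1≤j j≤1+n vanish with m≤n⇒m<n∨m≡n j≤1+n
  ... | inj₂ refl =
    ≈-trans (+-congʳ (sum1-zero n λ i 1≤i i≤n →
                        vanish i 1≤i (m≤n⇒m≤1+n i≤n) λ { refl → <⇒≱ (s≤s i≤n) ≤-refl }))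
            (+-identityˡ _)
  ... | inj₁ (s≤s j≤n) =
    ≈-trans (+-cong (sum1-single n 1≤j j≤n (allUpTo-init vanish))
                    (allUpTo-last vanish λ { refl → <⇒≱ (s≤s j≤n) ≤-refl }))
            (+-identityʳ _)

  sum1-split : ∀ (g : ℕ → Carrier) m n → sum1 R g (n ℕ.+ m) ≈ sum1 R g m + sum1 R (λ i → g (i ℕ.+ m)) n
  sum1-split g m zero    = ≈-sym (+-identityʳ _)
  sum1-split g m (suc n) = ≈-trans (+-congʳ (sum1-split g m n)) (+-assoc _ _ _)

  sum1-multiples : ∀ (g : ℕ → Carrier) p .{{_ : NonZero p}} k →
    sum1 R (λ i → if does (p ∣? i) then g i else 0#) (k ℕ.* p) ≈ sum1 R (λ j → g (j ℕ.* p)) k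
  sum1-multiples g p zero    = ≈-refl
  sum1-multiples g p (suc k) = begin
    sum1 R G (p ℕ.+ k ℕ.* p)                                 ≈⟨ sum1-split G (k ℕ.* p) p ⟩
    sum1 R G (k ℕ.* p) + sum1 R (λ t → G (t ℕ.+ k ℕ.* p)) p  ≈⟨ +-cong (sum1-multiples g p k)
                                                                 (sum1-single p (>-nonZero⁻¹ p) ≤-refl inside-block) ⟩
    sum1 R (λ j → g (j ℕ.* p)) k + G (p ℕ.+ k ℕ.* p)         ≈⟨ +-congˡ (if-yes (p ∣? _) (∣m∣n⇒∣m+n ∣-refl (n∣m*n k))) ⟩
    sum1 R (λ j → g (j ℕ.* p)) k + g (p ℕ.+ k ℕ.* p)         ∎
    where
    G : ℕ → Carrier
    G i = if does (p ∣? i) then g i else 0#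
    inside-block : AllUpTo p (λ t → t ≢ p → G (t ℕ.+ k ℕ.* p) ≈ 0#)
    inside-block t@(suc _) _ t≤p t≢p = if-no (p ∣? (t ℕ.+ k ℕ.* p)) λ p∣t+kp →
      t≢p (≤-antisym t≤p (∣⇒≤ (∣m+n∣m⇒∣n (subst (p ∣_) (ℕₚ.+-comm t (k ℕ.* p)) p∣t+kp) (n∣m*n k))))

  μ-nonZero : ∀ n .{{_ : NonZero n}} →
    μ R n ≡ (if squarefree n then (if ω n % 2 ≡ᵇ 0 then 1# else - 1#) else 0#)
  μ-nonZero (suc _) = refl

  μ≡0 : ∀ {n} → ¬ SquareFree n → μ R n ≡ 0#
  μ≡0 {zero}      _   = refl
  μ≡0 {n@(suc _)} ¬sf rewrite squarefree≡false n ¬sf = refl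

  μ[n*p] : ∀ {p n} .{{_ : NonZero n}} → Prime p → ¬ p ∣ n → μ R (n ℕ.* p) ≈ - μ R n
  μ[n*p] {p} {n} ⦃ n≢0 ⦄ prime-p p∤n
    rewrite μ-nonZero (n ℕ.* p) ⦃ m*n≢0 n p ⦃ n≢0 ⦄ ⦃ prime⇒nonZero prime-p ⦄ ⦄ | μ-nonZero n ⦃ n≢0 ⦄
          | squarefree[n*p] prime-p p∤n | ω[n*p] prime-p p∤n | even-suc (ω n)
    with squarefree n | ω n % 2 ≡ᵇ 0
  ... | false | _     = ≈-sym -0#≈0#
  ... | true  | true  = ≈-refl
  ... | true  | false = ≈-sym (-‿involutive 1#)

  μ∣ : ℕ → ℕ → Carrier
  μ∣ k n = if does (n ∣? k) then μ R n else 0#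

  sum1-μ∣1≈1 : ∀ N → 1 ≤ N → sum1 R (μ∣ 1) N ≈ 1#
  sum1-μ∣1≈1 N 1≤N = sum1-single N ≤-refl 1≤N λ n _ _ n≢1 → if-no (n ∣? 1) (n≢1 ∘ ∣1⇒≡1)

  sum1-μ∣[q*p]≈0 : ∀ {p} q .{{_ : NonZero q}} → Prime p → sum1 R (μ∣ (q ℕ.* p)) (q ℕ.* p) ≈ 0#
  sum1-μ∣[q*p]≈0 {p} q prime-p = begin
    sum1 R (μ∣ (q ℕ.* p)) (q ℕ.* p)                       ≈⟨ sum1-cong (q ℕ.* p) (λ n _ _ → split n) ⟩
    sum1 R (λ n → Y n + X n) (q ℕ.* p)                     ≈⟨ sum1-+ Y X (q ℕ.* p) ⟩
    sum1 R Y (q ℕ.* p) + sum1 R X (q ℕ.* p)                ≈⟨ +-cong (sum1-multiples (μ∣ (q ℕ.* p)) p q)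
                                                                     (sum1-extend (q ℕ.* p) (m≤m*n q p) X-beyond-q) ⟩
    sum1 R (λ j → μ∣ (q ℕ.* p) (j ℕ.* p)) q + sum1 R X q   ≈⟨ +-congʳ (sum1-cong q multiple-of-p) ⟩
    sum1 R (λ j → - X j) q + sum1 R X q                    ≈⟨ sum1-+ (λ j → - X j) X q ⟨
    sum1 R (λ j → - X j + X j) q                           ≈⟨ sum1-zero q (λ j _ _ → -‿inverseˡ (X j)) ⟩
    0#                                                     ∎
    where
    instance _ = prime⇒nonZero prime-p
    Y X : ℕ → Carrier
    Y n = if does (p ∣? n) then μ∣ (q ℕ.* p) n else 0#
    X n = if does (p ∣? n) then 0# else μ∣ q n
    ∣q*p⇔∣q : ∀ {n} → ¬ p ∣ n → n ∣ q ℕ.* p ⇔ n ∣ q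
    ∣q*p⇔∣q {n} p∤n = mk⇔ (coprime-divisor (prime∤⇒coprime prime-p p∤n) ∘ subst (n ∣_) (ℕₚ.*-comm q p))
                          (∣m⇒∣m*n p)
    split : ∀ n → μ∣ (q ℕ.* p) n ≈ (if does (p ∣? n) then μ∣ (q ℕ.* p) n else 0#)
                                   + (if does (p ∣? n) then 0# else μ∣ q n)
    split n with p ∣? n
    ... | yes _   = ≈-sym (+-identityʳ _)
    ... | no  p∤n = ≈-trans (reflexive (cong (λ b → if b then μ R n else 0#)
                                               (does-⇔ (∣q*p⇔∣q p∤n) (n ∣? q ℕ.* p) (n ∣? q))))
                            (≈-sym (+-identityˡ _))
    X-beyond-q : ∀ n → q < n → n ≤ q ℕ.* p → (if does (p ∣? n) then 0# else μ∣ q n) ≈ 0#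
    X-beyond-q n q<n _ with p ∣? n
    ... | yes _ = ≈-refl
    ... | no  _ = if-∣-beyond (μ R n) q<n
    multiple-of-p : AllUpTo q (λ j → μ∣ (q ℕ.* p) (j ℕ.* p) ≈ - (if does (p ∣? j) then 0# else μ∣ q j))
    multiple-of-p j 1≤j _ with p ∣? j
    ... | yes p∣j = ≈-trans (if-≈0 _ (reflexive (μ≡0 (¬squareFree[n*p] ⦃ prime⇒nonTrivial prime-p ⦄ p∣j))))
                            (≈-sym -0#≈0#)
    ... | no p∤j with j ℕ.* p ∣? q ℕ.* p | j ∣? q
    ... | yes _      | yes _    = μ[n*p] ⦃ >-nonZero 1≤j ⦄ prime-p p∤j
    ... | no  _      | no  _    = ≈-sym -0#≈0#
    ... | yes jp∣qp  | no  j∤q  = contradiction (*-cancelʳ-∣ p jp∣qp) j∤q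
    ... | no  jp∤qp  | yes j∣q  = contradiction (*-monoˡ-∣ p j∣q) jp∤qp

  sum1-μ∣≈0 : ∀ k .{{_ : NonTrivial k}} N → k ≤ N → sum1 R (μ∣ k) N ≈ 0#
  sum1-μ∣≈0 k N k≤N with ∃-prime-divisor k
  ... | p , prime-p , divides zero refl = contradiction refl (≢-nonZero⁻¹ 0 ⦃ nonTrivial⇒nonZero 0 ⦄)
  ... | p , prime-p , divides q@(suc _) refl =
    ≈-trans (sum1-extend N k≤N (λ n k<n _ → if-∣-beyond ⦃ k≢0 ⦄ (μ R n) k<n)) (sum1-μ∣[q*p]≈0 q prime-p)
    where k≢0 = m*n≢0 q p ⦃ _ ⦄ ⦃ prime⇒nonZero prime-p ⦄

  -- Σ_n möbiusTerm g m n is the Dirichlet convolution (μ ⋆ g)(m).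
  möbiusTerm : (ℕ → Carrier) → ℕ → ℕ → Carrier
  möbiusTerm g m zero      = 0#
  möbiusTerm g m n@(suc _) = if does (n ∣? m) then μ R n * g (m / n) else 0#

  divisorSum-extend : ∀ (f : ℕ → Carrier) {m} .{{_ : NonZero m}} N → m ≤ N →
    divisorSum R f m ≈ sum1 R (λ d → if does (d ∣? m) then f d else 0#) N
  divisorSum-extend f N m≤N = ≈-sym (sum1-extend N m≤N (λ d m<d _ → if-∣-beyond (f d) m<d))

  module _ (f : ℕ → Carrier) {M : ℕ} .{{_ : NonZero M}} where

    private
      term : ℕ → ℕ → Carrier
      term n d = if does (n ℕ.* d ∣? M) then μ R n * f d else 0#

    möbiusTerm-divisorSum : ∀ n .{{_ : NonZero n}} (n∣?M : Dec (n ∣ M)) →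
      (if does n∣?M then μ R n * divisorSum R f (M / n) else 0#) ≈ sum1 R (term n) M
    möbiusTerm-divisorSum n (no n∤M) =
      ≈-sym (sum1-zero M λ d _ _ → if-no (n ℕ.* d ∣? M) (n∤M ∘ m*n∣⇒m∣ n d))
    möbiusTerm-divisorSum n (yes n∣M) = begin
      μ R n * divisorSum R f (M / n)                                     ≈⟨ *-congˡ (divisorSum-extend f M (m/n≤m M n)) ⟩
      μ R n * sum1 R (λ d → if does (d ∣? M / n) then f d else 0#) M     ≈⟨ sum1-*ˡ (μ R n) _ M ⟨
      sum1 R (λ d → μ R n * (if does (d ∣? M / n) then f d else 0#)) M  ≈⟨ sum1-cong M (λ d _ _ → pointwise d) ⟩
      sum1 R (term n) M                                                  ∎
      where
      instance _ = >-nonZero (m≥n⇒m/n>0 (∣⇒≤ n∣M))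
      pointwise : ∀ d → μ R n * (if does (d ∣? M / n) then f d else 0#) ≈ term n d
      pointwise d = ≈-trans (*-if (μ R n) _ (f d))
        (reflexive (cong (λ b → if b then μ R n * f d else 0#)
          (does-⇔ (mk⇔ (m∣n/o⇒o*m∣n n∣M) (m*n∣o⇒n∣o/m n d)) (d ∣? M / n) (n ℕ.* d ∣? M))))

    sum1-term-over-n : ∀ {d} N .{{_ : NonZero d}} → d ∣ M →
      sum1 R (λ n → term n d) N ≈ sum1 R (μ∣ (M / d)) N * f d
    sum1-term-over-n {d} N d∣M = ≈-trans (sum1-cong N (λ n _ _ → pointwise n)) (sum1-*ʳ (f d) (μ∣ (M / d)) N)
      where
      pointwise : ∀ n → term n d ≈ μ∣ (M / d) n * f d
      pointwise n with n ℕ.* d ∣? M | n ∣? M / d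
      ... | yes _     | yes _     = ≈-refl
      ... | no  _     | no  _     = ≈-sym (zeroˡ (f d))
      ... | yes nd∣M  | no  n∤M/d = contradiction (m*n∣o⇒m∣o/n n d nd∣M) n∤M/d
      ... | no  nd∤M  | yes n∣M/d = contradiction (m∣n/o⇒m*o∣n d∣M n∣M/d) nd∤M

    möbius-inversion : ∀ N → M ≤ N → sum1 R (möbiusTerm (divisorSum R f) M) N ≈ f M
    möbius-inversion N M≤N = begin
      sum1 R (möbiusTerm (divisorSum R f) M) N    ≈⟨ sum1-cong N (λ { n@(suc _) _ _ → möbiusTerm-divisorSum n (n ∣? M) }) ⟩
      sum1 R (λ n → sum1 R (term n) M) N          ≈⟨ sum1-swap term N M ⟩
      sum1 R (λ d → sum1 R (λ n → term n d) N) M  ≈⟨ sum1-single M (>-nonZero⁻¹ M) ≤-refl only-d≡M ⟩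
      sum1 R (λ n → term n M) N                   ≈⟨ sum1-term-over-n N ∣-refl ⟩
      sum1 R (μ∣ (M / M)) N * f M                 ≡⟨ cong (λ k → sum1 R (μ∣ k) N * f M) (n/n≡1 M) ⟩
      sum1 R (μ∣ 1) N * f M                       ≈⟨ *-congʳ (sum1-μ∣1≈1 N (≤-trans (>-nonZero⁻¹ M) M≤N)) ⟩
      1# * f M                                    ≈⟨ *-identityˡ (f M) ⟩
      f M                                         ∎
      where
      only-d≡M : AllUpTo M (λ d → d ≢ M → sum1 R (λ n → term n d) N ≈ 0#)
      only-d≡M d 1≤d d≤M d≢M with d ∣? M
      ... | no  d∤M = sum1-zero N λ n _ _ → if-no (n ℕ.* d ∣? M) (d∤M ∘ m*n∣⇒n∣ n d)
      ... | yes d∣M =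
        ≈-trans (sum1-term-over-n N d∣M)
                (≈-trans (*-congʳ (sum1-μ∣≈0 (M / d) N (≤-trans (m/n≤m M d) M≤N))) (zeroˡ (f d)))
        where
        instance _ = >-nonZero 1≤d
        M/d≢1 : M / d ≢ 1
        M/d≢1 M/d≡1 = d≢M (trans (sym (ℕₚ.*-identityˡ d)) (trans (cong (ℕ._* d) (sym M/d≡1)) (m/n*n≡m d∣M)))
        instance _ = n>1⇒nonTrivial (≤∧≢⇒< (m≥n⇒m/n>0 d≤M) (M/d≢1 ∘ sym))

  lambert≡divisorSum : ∀ f m → lambert R f m ≡ divisorSum R f m
  lambert≡divisorSum f zero    = refl
  lambert≡divisorSum f (suc m) = refl

  lhsSeries≡summatory : ∀ f m → lhsSeries R f m ≡ summatory R f m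
  lhsSeries≡summatory f zero    = refl
  lhsSeries≡summatory f (suc m) = refl

  rhsTerm-coefficient : ∀ f k m →
    rhsTerm R f (suc k) m ≈ sum1 R (λ i → möbiusTerm (divisorSum R f) i (suc k)) m
  rhsTerm-coefficient f k m = ≈-trans (+-cong constant-term (sum1-cong m λ i _ _ → summand i)) (+-identityˡ _)
    where
    summand : ∀ i → (μ R (suc k) * substPow R (lambert R f) k i) * 1# ≈ möbiusTerm (divisorSum R f) i (suc k)
    summand i = ≈-trans (*-identityʳ _) (≈-trans (*-if (μ R (suc k)) _ _)
      (reflexive (cong (λ x → if does (suc k ∣? i) then μ R (suc k) * x else 0#)
                       (lambert≡divisorSum f (i / suc k)))))
    constant-term : (μ R (suc k) * substPow R (lambert R f) k 0) * 1# ≈ 0#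
    constant-term = ≈-trans (summand 0) (if-≈0 (does (suc k ∣? 0)) (zeroʳ (μ R (suc k))))

mainTheorem1 : {c ℓ : Level} (R : CommutativeRing c ℓ) (f : ℕ → CommutativeRing.Carrier R) →
    HasSum R (rhsTerm R f) (lhsSeries R f)
mainTheorem1 R f m = m , coefficient
  where
  open CommutativeRing R using (_≈_; setoid)
  open import Relation.Binary.Reasoning.Setoid setoid
  coefficient : ∀ N → m ≤ N → sum1 R (λ n → rhsTerm R f n m) N ≈ lhsSeries R f m
  coefficient N m≤N = begin
    sum1 R (λ n → rhsTerm R f n m) N
      ≈⟨ sum1-cong R N (λ { (suc k) _ _ → rhsTerm-coefficient R f k m }) ⟩
    sum1 R (λ n → sum1 R (λ i → möbiusTerm R (divisorSum R f) i n) m) N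
      ≈⟨ sum1-swap R (λ n i → möbiusTerm R (divisorSum R f) i n) N m ⟩
    sum1 R (λ i → sum1 R (möbiusTerm R (divisorSum R f) i) N) m
      ≈⟨ sum1-cong R m (λ i 1≤i i≤m → möbius-inversion R f ⦃ >-nonZero 1≤i ⦄ N (≤-trans i≤m m≤N)) ⟩
    summatory R f m
      ≡⟨ lhsSeries≡summatory R f m ⟨
    lhsSeries R f m
      ∎
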